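{- In intensional Martin-Löf type theory with weak propositional truncation, let $Y:\mathcal U$. Suppose that for all $y_1,y_2:Y$ the map $|{ - }|:(y_1=y_2)\to\lVert y_1=y_2\rVert$ is an epimorphism in the following sense: for every type $W:\mathcal U$ and all $f,g:\lVert y_1=y_2\rVert\to W$, $\big(\prod_{u:y_1=y_2}f(|u|)=g(|u|)\big)\to\prod_{v:\lVert y_1=y_2\rVert}f(v)=g(v)$. Then $Y$ is a set, i.e. $\prod_{y_1,y_2:Y}\prod_{p,q:y_1=y_2}p=q$.
   Context: Intensional Martin-Löf type theory with a universe $\mathcal U$, $\Sigma$, $\Pi$, $+$ and identity types (J only; no UIP/K). $\mathrm{isProp}(A):\equiv\prod_{a,b:A}a=b$. Weak propositional truncation: for every $A:\mathcal U$ a type $\lVert A\rVert:\mathcal U$ with $|{ - }|:A\to\lVert A\rVert$, a proof of $\mathrm{isProp}(\lVert A\rVert)$, and $\mathrm{rec}:\prod_{P:\mathcal U}\mathrm{isProp}(P)\to(A\to P)\to\lVert A\rVert\to P$ (no judgmental computation rule). -}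

{-# OPTIONS --without-K #-}
module Defs where

open import Agda.Primitive using (lsuc; lzero)
open import Data.Product using (Σ; _,_)
open import Relation.Binary.PropositionalEquality using (_≡_)

isProp : Set → Set
isProp A = (a b : A) → a ≡ b

isSet : Set → Set
isSet Y = (y₁ y₂ : Y) (p q : y₁ ≡ y₂) → p ≡ q

-- Weak propositional truncation: a type former with |-|, propositionality
-- and the (non-dependent) recursor; no judgmental computation rule is assumed.
record WeakTruncation : Set₁ where
  field
    ∥_∥   : Set → Set
    ∣_∣   : {A : Set} → A → ∥ A ∥
    ∥∥-isProp : {A : Set} → isProp ∥ A ∥
    rec   : {A : Set} (P : Set) → isProp P → (A → P) → ∥ A ∥ → P

isEpiTrunc : (T : WeakTruncation) → Set → Set₁
isEpiTrunc T A =
  (W : Set) (f g : ∥ A ∥ → W) →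
  ((u : A) → f ∣ u ∣ ≡ g ∣ u ∣) → (v : ∥ A ∥) → f v ≡ g v
  where open WeakTruncation T

{-# OPTIONS --without-K #-}
-- Applying the epimorphism property to the constant maps λ _ → y₁ and
-- λ _ → y₂ on ∥ y₁ ≡ y₂ ∥, which agree on ∣ u ∣ via u itself, gives a map
-- ∥ y₁ ≡ y₂ ∥ → y₁ ≡ y₂; precomposed with ∣_∣ it is a weakly constant
-- endomap of y₁ ≡ y₂, because ∥ y₁ ≡ y₂ ∥ is a proposition. As in Hedberg's
-- theorem, weakly constant endomaps on all path spaces out of y₁ make these
-- path spaces propositions, since every u equals (r refl)⁻¹ · r u.
module Submission where

open import Defs
open import Relation.Binary.PropositionalEquality
  using (_≡_; refl; sym; trans; cong; module ≡-Reasoning)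
open import Relation.Binary.PropositionalEquality.Properties using (trans-symˡ)

module _ {A : Set} {x : A} (r : {y : A} → x ≡ y → x ≡ y) where

  trans-sym-collapse : {y : A} (u : x ≡ y) → u ≡ trans (sym (r refl)) (r u)
  trans-sym-collapse refl = sym (trans-symˡ (r refl))

  weaklyConstant⇒paths-isProp :
    ({y : A} (p q : x ≡ y) → r p ≡ r q) → {y : A} → isProp (x ≡ y)
  weaklyConstant⇒paths-isProp const p q = begin
    p                           ≡⟨ trans-sym-collapse p ⟩
    trans (sym (r refl)) (r p)  ≡⟨ cong (trans (sym (r refl))) (const p q) ⟩
    trans (sym (r refl)) (r q)  ≡⟨ sym (trans-sym-collapse q) ⟩
    q                           ∎
    where open ≡-Reasoning

module _ (T : WeakTruncation) where
  open WeakTruncation T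

  epi⇒trunc-rec-paths : {A B : Set} {a b : B} →
    isEpiTrunc T A → (A → a ≡ b) → ∥ A ∥ → a ≡ b
  epi⇒trunc-rec-paths {B = B} {a} {b} epi = epi B (λ _ → a) (λ _ → b)

  epi⇒paths-collapse : {Y : Set} {y₁ y₂ : Y} →
    isEpiTrunc T (y₁ ≡ y₂) → y₁ ≡ y₂ → y₁ ≡ y₂
  epi⇒paths-collapse epi u = epi⇒trunc-rec-paths epi (λ v → v) ∣ u ∣

  epi⇒paths-collapse-const : {Y : Set} {y₁ y₂ : Y} (epi : isEpiTrunc T (y₁ ≡ y₂))
    (p q : y₁ ≡ y₂) → epi⇒paths-collapse epi p ≡ epi⇒paths-collapse epi q
  epi⇒paths-collapse-const epi p q =
    cong (epi⇒trunc-rec-paths epi (λ v → v)) (∥∥-isProp ∣ p ∣ ∣ q ∣)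

lemma7p4 : (T : WeakTruncation) (Y : Set) →
    ((y₁ y₂ : Y) → isEpiTrunc T (y₁ ≡ y₂)) →
    isSet Y
lemma7p4 T Y epi y₁ y₂ =
  weaklyConstant⇒paths-isProp (λ {y} → epi⇒paths-collapse T (epi y₁ y))
    (λ {y} → epi⇒paths-collapse-const T (epi y₁ y))
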